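{- Let $n\geq 3$ be an integer and let $(x_1,\ldots,x_n)$ be positive integers with $x_1\leq\cdots\leq x_n$ satisfying $\sigma_2(x_1,\ldots,x_n)=\sigma_n(x_1,\ldots,x_n)$. If $n\geq 6$ then $x_1=1$. If $n\geq 8$ then $x_1=x_2=1$.
   Context: $\sigma_k$ denotes the $k$-th elementary symmetric polynomial in $n$ variables. -}

module Defs where

open import Data.Nat using (ℕ; zero; suc; _+_; _*_)
open import Data.Vec using (Vec; []; _∷_)

-- σ k xs : the k-th elementary symmetric polynomial evaluated at xs,
-- i.e. the sum over all k-element subsets S of the positions of ∏_{i∈S} x_i.
σ : ∀ {n} → ℕ → Vec ℕ n → ℕ
σ zero    _        = 1
σ (suc k) []       = 0
σ (suc k) (x ∷ xs) = x * σ k xs + σ (suc k) xs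

{-# OPTIONS --safe #-}
-- If every entry is at least 2, each of the (n choose k) monomials of σₖ is at most
-- σₙ / 2^(n − k), because the n − k missing factors are each at least 2. If x₁ ≥ 2, this turns
-- σ₂ = σₙ into 2^(n − 2) ≤ (n choose 2), which fails for n ≥ 6. If x₁ = 1 < x₂, write
-- x = 1 ∷ w: then σ₂(x) = σ₁(w) + σ₂(w) and σₙ(x) = σₙ₋₁(w), and the same bound for w gives
-- 2^(n − 3) ≤ (n choose 2), which fails for n ≥ 8.
module Submission where

open import Defs
open import Data.Nat using (ℕ; _+_; _≤_; _≥_; _*_; _^_; zero; suc; z≤n; s≤s; _<_; _≤′_; ≤′-refl; ≤′-step; >-nonZero)
open import Data.Nat.Properties
open import Data.Nat.Combinatorics using (_C_; nC1≡n; nCk+nC[k+1]≡[n+1]C[k+1])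
open import Data.Nat.Solver using (module +-*-Solver)
open import Data.Fin using (toℕ; zero; suc)
open import Data.Vec using (Vec; lookup; []; _∷_)
open import Data.Product using (_×_; _,_)
open import Data.Sum using (inj₁; inj₂)
open import Data.Empty using (⊥-elim)
open import Relation.Binary.PropositionalEquality
open +-*-Solver using (solve; _:+_; _:*_; con; _:=_)

σ-vanishes : ∀ {n} k (v : Vec ℕ n) → n < k → σ k v ≡ 0
σ-vanishes (suc k) []       _       = refl
σ-vanishes (suc k) (x ∷ v) (s≤s n<k) = begin
  x * σ k v + σ (suc k) v ≡⟨ cong₂ (λ a b → x * a + b) (σ-vanishes k v n<k)
                                                       (σ-vanishes (suc k) v (m≤n⇒m≤1+n n<k)) ⟩
  x * 0 + 0               ≡⟨ cong (_+ 0) (*-zeroʳ x) ⟩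
  0                       ∎
  where open ≡-Reasoning

σ-top : ∀ {n} x (v : Vec ℕ n) → σ (suc n) (x ∷ v) ≡ x * σ n v
σ-top {n} x v = trans (cong (x * σ n v +_) (σ-vanishes (suc n) v ≤-refl)) (+-identityʳ _)

a^n≤σₙ : ∀ {n} a (v : Vec ℕ n) → (∀ i → a ≤ lookup v i) → a ^ n ≤ σ n v
a^n≤σₙ a []      _ = ≤-refl
a^n≤σₙ {suc n} a (x ∷ v) h = begin
  a * a ^ n         ≤⟨ *-mono-≤ (h zero) (a^n≤σₙ a v (λ i → h (suc i))) ⟩
  x * σ n v         ≡⟨ σ-top x v ⟨
  σ (suc n) (x ∷ v) ∎
  where open ≤-Reasoning

2^d*σₖ≤nCk*σₙ : ∀ {n} k d (v : Vec ℕ n) → k + d ≡ n → (∀ i → 2 ≤ lookup v i) →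
  2 ^ d * σ k v ≤ (n C k) * σ n v
2^d*σₖ≤nCk*σₙ zero d v refl h = begin
  2 ^ d * 1 ≡⟨ *-identityʳ (2 ^ d) ⟩
  2 ^ d     ≤⟨ a^n≤σₙ 2 v h ⟩
  σ d v     ≡⟨ *-identityˡ (σ d v) ⟨
  1 * σ d v ∎
  where open ≤-Reasoning
2^d*σₖ≤nCk*σₙ {suc n} (suc k) d (x ∷ w) k+d≡n h = begin
  2 ^ d * (x * σ k w + σ (suc k) w)
    ≡⟨ solve 4 (λ p x s t → p :* (x :* s :+ t) := x :* (p :* s) :+ p :* t)
               refl (2 ^ d) x (σ k w) (σ (suc k) w) ⟩
  x * (2 ^ d * σ k w) + 2 ^ d * σ (suc k) w
    ≤⟨ +-mono-≤ (*-monoʳ-≤ x (2^d*σₖ≤nCk*σₙ k d w (suc-injective k+d≡n) (λ i → h (suc i))))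
                (tail-bound d (suc-injective k+d≡n)) ⟩
  x * ((n C k) * P) + x * ((n C suc k) * P)
    ≡⟨ solve 4 (λ x a b p → x :* (a :* p) :+ x :* (b :* p) := (a :+ b) :* (x :* p))
               refl x (n C k) (n C suc k) P ⟩
  (n C k + n C suc k) * (x * P)
    ≡⟨ cong₂ _*_ (nCk+nC[k+1]≡[n+1]C[k+1] n k) (sym (σ-top x w)) ⟩
  (suc n C suc k) * σ (suc n) (x ∷ w)
    ∎
  where
  open ≤-Reasoning
  P = σ n w
  tail-bound : ∀ d → k + d ≡ n → 2 ^ d * σ (suc k) w ≤ x * ((n C suc k) * P)
  tail-bound zero k+0≡n
    rewrite σ-vanishes (suc k) w (s≤s (≤-reflexive (trans (sym k+0≡n) (+-identityʳ k)))) = z≤n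
  tail-bound (suc d) k+d≡n = ≤-trans (≤-reflexive (*-assoc 2 (2 ^ d) _)) (*-mono-≤ (h zero)
    (2^d*σₖ≤nCk*σₙ (suc k) d w (trans (sym (+-suc k d)) k+d≡n) (λ i → h (suc i))))

2^m*σ₂[1∷w]≤[3+m]C2*σ[1∷w] : ∀ m (w : Vec ℕ (2 + m)) → (∀ i → 2 ≤ lookup w i) →
  2 ^ m * σ 2 (1 ∷ w) ≤ ((3 + m) C 2) * σ (3 + m) (1 ∷ w)
2^m*σ₂[1∷w]≤[3+m]C2*σ[1∷w] m w h = begin
  2 ^ m * (1 * σ 1 w + σ 2 w)
    ≡⟨ solve 3 (λ p s t → p :* (con 1 :* s :+ t) := p :* s :+ p :* t) refl (2 ^ m) (σ 1 w) (σ 2 w) ⟩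
  2 ^ m * σ 1 w + 2 ^ m * σ 2 w
    ≤⟨ +-monoˡ-≤ (2 ^ m * σ 2 w) (*-monoˡ-≤ (σ 1 w) (^-monoʳ-≤ 2 (n≤1+n m))) ⟩
  2 ^ (1 + m) * σ 1 w + 2 ^ m * σ 2 w
    ≤⟨ +-mono-≤ (2^d*σₖ≤nCk*σₙ 1 (1 + m) w refl h) (2^d*σₖ≤nCk*σₙ 2 m w refl h) ⟩
  ((2 + m) C 1) * P + ((2 + m) C 2) * P
    ≡⟨ *-distribʳ-+ P ((2 + m) C 1) ((2 + m) C 2) ⟨
  ((2 + m) C 1 + (2 + m) C 2) * P
    ≡⟨ cong₂ _*_ (nCk+nC[k+1]≡[n+1]C[k+1] (2 + m) 1) (sym (trans (σ-top 1 w) (*-identityˡ P))) ⟩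
  ((3 + m) C 2) * σ (3 + m) (1 ∷ w)
    ∎
  where
  open ≤-Reasoning
  P = σ (2 + m) w

σ₂≡σₙ⇒pow≤coeff : ∀ {n} e c (x : Vec ℕ n) → (∀ i → 1 ≤ lookup x i) → σ 2 x ≡ σ n x →
  2 ^ e * σ 2 x ≤ c * σ n x → 2 ^ e ≤ c
σ₂≡σₙ⇒pow≤coeff {n} e c x pos σ₂≡σₙ le =
  *-cancelʳ-≤ (2 ^ e) c (σ n x) {{>-nonZero σₙ>0}} (subst (λ s → 2 ^ e * s ≤ c * σ n x) σ₂≡σₙ le)
  where
  σₙ>0 : 0 < σ n x
  σₙ>0 = ≤-trans (≤-reflexive (sym (^-zeroˡ n))) (a^n≤σₙ 1 x pos)

2*[1+n]C2≡[1+n]*n : ∀ n → 2 * (suc n C 2) ≡ suc n * n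
2*[1+n]C2≡[1+n]*n zero    = refl
2*[1+n]C2≡[1+n]*n (suc n) = begin
  2 * ((2 + n) C 2)                 ≡⟨ cong (2 *_) (nCk+nC[k+1]≡[n+1]C[k+1] (suc n) 1) ⟨
  2 * (suc n C 1 + suc n C 2)       ≡⟨ *-distribˡ-+ 2 (suc n C 1) (suc n C 2) ⟩
  2 * (suc n C 1) + 2 * (suc n C 2) ≡⟨ cong₂ _+_ (cong (2 *_) (nC1≡n (suc n))) (2*[1+n]C2≡[1+n]*n n) ⟩
  2 * suc n + suc n * n             ≡⟨ solve 1 (λ n → con 2 :* (con 1 :+ n) :+ (con 1 :+ n) :* n
                                                 := (con 2 :+ n) :* (con 1 :+ n)) refl n ⟩
  (2 + n) * suc n                   ∎
  where open ≡-Reasoning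

pow-dominates-sub-doubling : (g : ℕ → ℕ) → (∀ m → g (suc m) ≤ 2 * g m) →
  ∀ {c m₀ m} → g m₀ < 2 ^ (m₀ + c) → m₀ ≤′ m → g m < 2 ^ (m + c)
pow-dominates-sub-doubling g step     base ≤′-refl             = base
pow-dominates-sub-doubling g step {c} base (≤′-step {m} m₀≤′m) = begin-strict
  g (suc m)   ≤⟨ step m ⟩
  2 * g m     <⟨ *-monoʳ-< 2 (pow-dominates-sub-doubling g step base m₀≤′m) ⟩
  2 * 2 ^ (m + c) ∎
  where open ≤-Reasoning

[4+m]*[3+m]≤2*[3+m]*[2+m] : ∀ m → (4 + m) * (3 + m) ≤ 2 * ((3 + m) * (2 + m))
[4+m]*[3+m]≤2*[3+m]*[2+m] m = begin
  (4 + m) * (3 + m)                   ≤⟨ m≤m+n _ (m * (3 + m)) ⟩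
  (4 + m) * (3 + m) + m * (3 + m)     ≡⟨ solve 1 (λ m → (con 4 :+ m) :* (con 3 :+ m) :+ m :* (con 3 :+ m)
                                            := con 2 :* ((con 3 :+ m) :* (con 2 :+ m))) refl m ⟩
  2 * ((3 + m) * (2 + m))             ∎
  where open ≤-Reasoning

[3+m]C2<2^[m+c] : ∀ c m₀ {m} → (3 + m₀) * (2 + m₀) < 2 ^ (m₀ + suc c) → m₀ ≤ m →
  (3 + m) C 2 < 2 ^ (m + c)
[3+m]C2<2^[m+c] c m₀ {m} base m₀≤m = *-cancelˡ-< 2 _ _ (begin-strict
  2 * ((3 + m) C 2) ≡⟨ 2*[1+n]C2≡[1+n]*n (2 + m) ⟩
  (3 + m) * (2 + m) <⟨ pow-dominates-sub-doubling (λ m → (3 + m) * (2 + m))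
                         [4+m]*[3+m]≤2*[3+m]*[2+m] base (≤⇒≤′ m₀≤m) ⟩
  2 ^ (m + suc c)   ≡⟨ cong (2 ^_) (+-suc m c) ⟩
  2 * 2 ^ (m + c)   ∎)
  where open ≤-Reasoning

smallest-entry-one : ∀ m (x : Vec ℕ (3 + m)) → (∀ i → 1 ≤ lookup x i) →
  (∀ i → lookup x zero ≤ lookup x i) → σ 2 x ≡ σ (3 + m) x → 3 ≤ m → lookup x zero ≡ 1
smallest-entry-one m x pos minimal σ₂≡σₙ 3≤m with m≤n⇒m<n∨m≡n (pos zero)
... | inj₂ 1≡x₀ = sym 1≡x₀
... | inj₁ 2≤x₀ = ⊥-elim (<⇒≱ ([3+m]C2<2^[m+c] 1 3 (≤ᵇ⇒≤ 31 32 _) 3≤m)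
  (σ₂≡σₙ⇒pow≤coeff (m + 1) _ x pos σ₂≡σₙ
    (2^d*σₖ≤nCk*σₙ 2 (m + 1) x (cong (2 +_) (+-comm m 1)) (λ i → ≤-trans 2≤x₀ (minimal i)))))

second-entry-one : ∀ m x₀ (w : Vec ℕ (2 + m)) → x₀ ≡ 1 → (∀ i → 1 ≤ lookup (x₀ ∷ w) i) →
  (∀ i → lookup w zero ≤ lookup w i) → σ 2 (x₀ ∷ w) ≡ σ (3 + m) (x₀ ∷ w) → 5 ≤ m →
  lookup w zero ≡ 1
second-entry-one m x₀ w refl pos minimal σ₂≡σₙ 5≤m with m≤n⇒m<n∨m≡n (pos (suc zero))
... | inj₂ 1≡x₁ = sym 1≡x₁
... | inj₁ 2≤x₁ = ⊥-elim (<⇒≱ ([3+m]C2<2^[m+c] 0 5 (≤ᵇ⇒≤ 57 64 _) 5≤m)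
  (subst (_≤ (3 + m) C 2) (cong (2 ^_) (sym (+-identityʳ m)))
    (σ₂≡σₙ⇒pow≤coeff m _ (1 ∷ w) pos σ₂≡σₙ
      (2^m*σ₂[1∷w]≤[3+m]C2*σ[1∷w] m w (λ i → ≤-trans 2≤x₁ (minimal i))))))

corollary2p4 : ∀ (m : ℕ) → (x : Vec ℕ (3 + m)) →
    (∀ i → 1 ≤ lookup x i) →
    (∀ i j → toℕ i ≤ toℕ j → lookup x i ≤ lookup x j) →
    σ 2 x ≡ σ (3 + m) x →
    ((3 + m ≥ 6 → lookup x zero ≡ 1)
      × (3 + m ≥ 8 → (lookup x zero ≡ 1 × lookup x (suc zero) ≡ 1)))
corollary2p4 m (x₀ ∷ w) pos sorted σ₂≡σₙ = x₀≡1 , λ n≥8 → x₀≡1 (≤-trans 6≤8 n≥8) , x₁≡1 n≥8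
  where
  6≤8 : 6 ≤ 8
  6≤8 = ≤ᵇ⇒≤ 6 8 _
  x₀≡1 : 3 + m ≥ 6 → x₀ ≡ 1
  x₀≡1 n≥6 = smallest-entry-one m (x₀ ∷ w) pos (λ i → sorted zero i z≤n) σ₂≡σₙ (+-cancelˡ-≤ 3 3 m n≥6)
  x₁≡1 : 3 + m ≥ 8 → lookup w zero ≡ 1
  x₁≡1 n≥8 = second-entry-one m x₀ w (x₀≡1 (≤-trans 6≤8 n≥8)) pos
    (λ i → sorted (suc zero) (suc i) (s≤s z≤n)) σ₂≡σₙ (+-cancelˡ-≤ 3 5 m n≥8)
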